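{- Let $N\ge 2$ and $k$ be positive integers with $k\le \frac{N}{2}$, and let $\gamma_i\in\{0,1\}$ for $i=1,\dots,k-1$. Suppose that $m,n$ are positive integers and $$2^{N}+2^{k}+\sum_{i=1}^{k-1}\gamma_{i}2^{i}+1=\left(2^{m}+\sum_{i=1}^{m-1}\alpha_{i}2^{i}+1\right)\left(2^{n}+\sum_{j=1}^{n-1}\beta_{j}2^{j}+1\right),$$ where $\alpha_i\in\{0,1\}$ for $i=1,\dots,m-1$ and $\beta_j\in\{0,1\}$ for $j=1,\dots,n-1$. Then $m+n=N-1$.
   Context: Empty sums are zero. -}

module Defs where

open import Data.Nat using (ℕ; zero; suc; _+_; _*_; _^_)
open import Data.Bool using (Bool; true; false)
open import Data.Fin using (Fin; toℕ)
open import Data.Fin as F using ()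

bitVal : Bool → ℕ
bitVal true  = 1
bitVal false = 0

-- bitSum L c = Σ_{i=1}^{L} c_i 2^i, where entry j : Fin L of c is the
-- coefficient c_{j+1} of 2^(j+1). Empty sum (L = 0) is 0.
bitSum : (L : ℕ) → (Fin L → Bool) → ℕ
bitSum zero    c = 0
bitSum (suc L) c = bitVal (c (F.fromℕ L)) * 2 ^ suc L + bitSum L (λ j → c (F.inject₁ j))

module Submission where

-- Write A = 2^m + a + 1 and B = 2^n + b + 1, where a and b are
-- the bit sums, and L = 2^N + 2^k + g + 1 for the left-hand side.  A bit sum
-- of length ℓ is at most 2^(ℓ+1) - 2, so every number of the shape
-- 2^e + x + 1 lies strictly between 2^e and 2^(e+1).  Hence
--   2^N ≤ L = A * B < 2^(m+n+2)                 gives  N ≤ m + n + 1,  and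
--   2^(m+n) + 2^m + 2^n < A * B = L < 2^N + 2^(k+1) ≤ 2^(N+1)
-- gives m + n ≤ N.  Equality N = m + n is impossible because 2k ≤ N forces
-- 2^(k+1) ≤ 2^m + 2^n (one of m, n exceeds k, or both equal k).

open import Defs
open import Data.Nat using (ℕ; zero; suc; _+_; _*_; _∸_; _^_; _≤_; _<_; z≤n; s≤s)
open import Data.Nat.Properties
open import Data.Bool using (Bool; true; false)
open import Data.Fin as F using (Fin)
open import Relation.Nullary using (yes; no; ¬_; contradiction)
open import Relation.Binary.PropositionalEquality
  using (_≡_; refl; sym; cong; cong₂; subst; module ≡-Reasoning)
open import Data.Nat.Solver using (module +-*-Solver)
open +-*-Solver using (solve; _:+_; _:*_; _:=_; con)

bitVal≤1 : ∀ b → bitVal b ≤ 1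
bitVal≤1 true  = s≤s z≤n
bitVal≤1 false = z≤n

double-power : ∀ e → 2 ^ e + 2 ^ e ≡ 2 ^ suc e
double-power e = solve 1 (λ p → p :+ p := con 2 :* p) refl (2 ^ e)

bitSum-bound : ∀ ℓ c → bitSum ℓ c + 2 ≤ 2 ^ suc ℓ
bitSum-bound zero    c = ≤-refl
bitSum-bound (suc ℓ) c = begin
  x * P + s + 2   ≡⟨ +-assoc (x * P) s 2 ⟩
  x * P + (s + 2) ≤⟨ +-mono-≤ (*-monoˡ-≤ P (bitVal≤1 (c (F.fromℕ ℓ)))) (bitSum-bound ℓ _) ⟩
  1 * P + P       ≡⟨ cong (_+ P) (*-identityˡ P) ⟩
  P + P           ≡⟨ double-power (suc ℓ) ⟩
  2 ^ suc (suc ℓ) ∎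
  where
  open ≤-Reasoning
  P x s : ℕ
  P = 2 ^ suc ℓ
  x = bitVal (c (F.fromℕ ℓ))
  s = bitSum ℓ (λ j → c (F.inject₁ j))

leading-bit-upper : ∀ e x → x + 2 ≤ 2 ^ e → 2 ^ e + x + 1 < 2 ^ suc e
leading-bit-upper e x x+2≤P = begin
  suc (P + x + 1) ≡⟨ solve 2 (λ p y → con 1 :+ (p :+ y :+ con 1) := p :+ (y :+ con 2)) refl P x ⟩
  P + (x + 2)     ≤⟨ +-monoʳ-≤ P x+2≤P ⟩
  P + P           ≡⟨ double-power e ⟩
  2 ^ suc e       ∎
  where
  open ≤-Reasoning
  P : ℕ
  P = 2 ^ e

product-upper : ∀ m n A B → A < 2 ^ suc m → B < 2 ^ suc n → A * B < 2 ^ suc (suc (m + n))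
product-upper m n A B A< B< = begin-strict
  A * B                 <⟨ *-mono-< A< B< ⟩
  2 ^ suc m * 2 ^ suc n ≡⟨ sym (^-distribˡ-+-* 2 (suc m) (suc n)) ⟩
  2 ^ (suc m + suc n)   ≡⟨ cong (λ e → 2 ^ suc e) (+-suc m n) ⟩
  2 ^ suc (suc (m + n)) ∎
  where open ≤-Reasoning

product-lower : ∀ P Q a b → P * Q + (P + Q) < (P + a + 1) * (Q + b + 1)
product-lower P Q a b = begin
  suc (P * Q + (P + Q))     ≡⟨ solve 2 (λ p q → con 1 :+ (p :* q :+ (p :+ q)) := (p :+ con 1) :* (q :+ con 1)) refl P Q ⟩
  (P + 1) * (Q + 1)         ≤⟨ *-mono-≤ (+-monoˡ-≤ 1 (m≤m+n P a)) (+-monoˡ-≤ 1 (m≤m+n Q b)) ⟩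
  (P + a + 1) * (Q + b + 1) ∎
  where open ≤-Reasoning

-- If 2k ≤ m + n then 2^(k+1) ≤ 2^m + 2^n: either m or n exceeds k,
-- or m = n = k and both sides equal 2^k + 2^k.
power-split : ∀ k m n → 2 * k ≤ m + n → 2 ^ suc k ≤ 2 ^ m + 2 ^ n
power-split k m n 2k≤m+n with k <? m | k <? n
... | yes k<m | _       = ≤-trans (^-monoʳ-≤ 2 k<m) (m≤m+n (2 ^ m) (2 ^ n))
... | no _    | yes k<n = ≤-trans (^-monoʳ-≤ 2 k<n) (m≤n+m (2 ^ n) (2 ^ m))
... | no k≮m  | no k≮n  = ≤-reflexive (begin
  2 ^ suc k     ≡⟨ sym (double-power k) ⟩
  2 ^ k + 2 ^ k ≡⟨ cong₂ _+_ (cong (2 ^_) (sym m≡k)) (cong (2 ^_) (sym n≡k)) ⟩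
  2 ^ m + 2 ^ n ∎)
  where
  open ≡-Reasoning
  m≤k : m ≤ k
  m≤k = ≮⇒≥ k≮m
  n≤k : n ≤ k
  n≤k = ≮⇒≥ k≮n
  k+k≤m+n : k + k ≤ m + n
  k+k≤m+n = subst (_≤ m + n) (cong (k +_) (+-identityʳ k)) 2k≤m+n
  m≡k : m ≡ k
  m≡k = ≤-antisym m≤k (+-cancelʳ-≤ k k m (≤-trans k+k≤m+n (+-monoʳ-≤ m n≤k)))
  n≡k : n ≡ k
  n≡k = ≤-antisym n≤k (+-cancelˡ-≤ k k n (≤-trans k+k≤m+n (+-monoˡ-≤ n m≤k)))

^-reflect-< : ∀ a b → 2 ^ a < 2 ^ b → a < b
^-reflect-< a b 2^a<2^b with a <? b
... | yes a<b = a<b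
... | no  a≮b = contradiction (^-monoʳ-≤ 2 (≮⇒≥ a≮b)) (<⇒≱ 2^a<2^b)

product-exponent : ∀ N k m n a b g →
  a + 2 ≤ 2 ^ m → b + 2 ≤ 2 ^ n → g + 2 ≤ 2 ^ k → 1 ≤ k → 2 * k ≤ N →
  2 ^ N + 2 ^ k + g + 1 ≡ (2 ^ m + a + 1) * (2 ^ n + b + 1) →
  suc (m + n) ≡ N
product-exponent N k m n a b g a-bound b-bound g-bound 1≤k 2k≤N L≡AB =
  ≤-antisym (≤∧≢⇒< m+n≤N m+n≢N) N≤1+m+n
  where
  open ≤-Reasoning
  P Q T L AB : ℕ
  P = 2 ^ m
  Q = 2 ^ n
  T = 2 ^ N
  L = T + 2 ^ k + g + 1
  AB = (P + a + 1) * (Q + b + 1)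

  -- k + 1 ≤ k + k ≤ N, so 2^N + 2^(k+1) ≤ 2^(N+1).
  k<N : suc k ≤ N
  k<N = ≤-trans (+-monoˡ-≤ k 1≤k) (subst (_≤ N) (cong (k +_) (+-identityʳ k)) 2k≤N)

  L-split : L ≡ T + (2 ^ k + g + 1)
  L-split = begin-equality
    L                   ≡⟨ cong (_+ 1) (+-assoc T (2 ^ k) g) ⟩
    T + (2 ^ k + g) + 1 ≡⟨ +-assoc T (2 ^ k + g) 1 ⟩
    T + (2 ^ k + g + 1) ∎

  N≤1+m+n : N ≤ suc (m + n)
  N≤1+m+n = ≤-pred (^-reflect-< N (suc (suc (m + n))) (begin-strict
    T                   ≤⟨ m≤m+n T _ ⟩
    T + (2 ^ k + g + 1) ≡⟨ sym L-split ⟩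
    L                   ≡⟨ L≡AB ⟩
    AB                  <⟨ product-upper m n _ _ (leading-bit-upper m a a-bound) (leading-bit-upper n b b-bound) ⟩
    2 ^ suc (suc (m + n)) ∎))

  L-upper : L < T + 2 ^ suc k
  L-upper = begin-strict
    L                   ≡⟨ L-split ⟩
    T + (2 ^ k + g + 1) <⟨ +-monoʳ-< T (leading-bit-upper k g g-bound) ⟩
    T + 2 ^ suc k       ∎

  sandwich : 2 ^ (m + n) + (P + Q) < T + 2 ^ suc k
  sandwich = begin-strict
    2 ^ (m + n) + (P + Q) ≡⟨ cong (_+ (P + Q)) (^-distribˡ-+-* 2 m n) ⟩
    P * Q + (P + Q)       <⟨ product-lower P Q a b ⟩
    AB                    ≡⟨ sym L≡AB ⟩
    L                     <⟨ L-upper ⟩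
    T + 2 ^ suc k         ∎

  m+n≤N : m + n ≤ N
  m+n≤N = ≤-pred (^-reflect-< (m + n) (suc N) (begin-strict
    2 ^ (m + n)           ≤⟨ m≤m+n _ (P + Q) ⟩
    2 ^ (m + n) + (P + Q) <⟨ sandwich ⟩
    T + 2 ^ suc k         ≤⟨ +-monoʳ-≤ T (^-monoʳ-≤ 2 k<N) ⟩
    T + T                 ≡⟨ double-power N ⟩
    2 ^ suc N             ∎))

  m+n≢N : ¬ (m + n ≡ N)
  m+n≢N m+n≡N = <⇒≱ sandwich (begin
    T + 2 ^ suc k         ≤⟨ +-monoʳ-≤ T (power-split k m n (subst (2 * k ≤_) (sym m+n≡N) 2k≤N)) ⟩
    T + (P + Q)           ≡⟨ cong (λ e → 2 ^ e + (P + Q)) (sym m+n≡N) ⟩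
    2 ^ (m + n) + (P + Q) ∎)

corollary1 : (N k : ℕ) → 2 ≤ N → 1 ≤ k → 2 * k ≤ N →
    (γ : Fin (k ∸ 1) → Bool) →
    (m n : ℕ) → 1 ≤ m → 1 ≤ n →
    (α : Fin (m ∸ 1) → Bool) → (β : Fin (n ∸ 1) → Bool) →
    2 ^ N + 2 ^ k + bitSum (k ∸ 1) γ + 1
    ≡ (2 ^ m + bitSum (m ∸ 1) α + 1) * (2 ^ n + bitSum (n ∸ 1) β + 1) →
    m + n ≡ N ∸ 1
corollary1 N (suc k) _ 1≤k 2k≤N γ (suc m) (suc n) _ _ α β eq =
  cong (_∸ 1) (product-exponent N (suc k) (suc m) (suc n) _ _ _
    (bitSum-bound m α) (bitSum-bound n β) (bitSum-bound k γ) 1≤k 2k≤N eq)
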